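{- Let $T$ be a finite rooted planar tree. The set of grafted trees $(A;B_1,\dots,B_{d(A)})$ with skeleton $T$ is in bijection with the set of restricted morphisms $\mu:T\to\{1,2\}$.
   Context: A finite rooted planar tree has a root $r$, edges oriented away from the root (an edge $e$ goes from the father $\alpha(e)$ to the son $\omega(e)$), and totally ordered sons at each vertex; leaves are vertices without sons. The vertex set of $T$ is a poset with the order generated by $\omega(e)>\alpha(e)$ for every edge $e$. $\{1,2\}$ is totally ordered with $1<2$. A morphism $\mu:T\to\{1,2\}$ is a map on vertices with $\mu(\omega(e))\geq\mu(\alpha(e))$ for every edge $e$; it is restricted if $\mu^{ -1}(2)$ contains all leaves of $T$. A grafted tree is a tuple $(A;B_1,\dots,B_{d(A)})$ of finite rooted planar trees where $A$ has $d(A)$ leaves; its skeleton is the tree obtained by gluing the root of $B_1$ onto the leftmost (smallest) leaf of $A$, the root of $B_2$ onto the second leaf of $A$, and so on. -}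

module Defs where

open import Data.Nat using (ℕ; zero; suc; _+_)
open import Data.List using (List; []; _∷_; length; lookup)
open import Data.Fin using (Fin)
open import Data.Vec using (Vec; take; drop) renaming ([] to []ᵥ; _∷_ to _∷ᵥ_)
open import Data.Product using (Σ; _,_)
open import Relation.Binary.Bundles using (Setoid)
open import Relation.Binary.PropositionalEquality as ≡ using (_≡_; refl)

data Tree : Set where
  node : List Tree → Tree

sons : Tree → List Tree
sons (node ts) = ts

data Vertex : Tree → Set where
  root  : ∀ {t} → Vertex t
  child : ∀ {ts} (i : Fin (length ts)) → Vertex (lookup ts i) → Vertex (node ts)

data Edge : Tree → Set where
  top    : ∀ {ts} (i : Fin (length ts)) → Edge (node ts)
  deeper : ∀ {ts} (i : Fin (length ts)) → Edge (lookup ts i) → Edge (node ts)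

α : ∀ {t} → Edge t → Vertex t
α (top i)      = root
α (deeper i e) = child i (α e)

ω : ∀ {t} → Edge t → Vertex t
ω (top i)      = child i root
ω (deeper i e) = child i (ω e)

subtree : ∀ {t} → Vertex t → Tree
subtree {t} root = t
subtree (child i v) = subtree v

IsLeaf : ∀ {t} → Vertex t → Set
IsLeaf v = sons (subtree v) ≡ []

data Two : Set where
  one two : Two

data _≤₂_ : Two → Two → Set where
  1≤1 : one ≤₂ one
  1≤2 : one ≤₂ two
  2≤2 : two ≤₂ two

record RestrictedMorphism (T : Tree) : Set where
  field
    μ          : Vertex T → Two
    monotone   : (e : Edge T) → μ (α e) ≤₂ μ (ω e)
    restricted : (v : Vertex T) → IsLeaf v → μ v ≡ two
open RestrictedMorphism public

RestrictedMorphismSetoid : Tree → Setoid _ _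
RestrictedMorphismSetoid T = record
  { Carrier = RestrictedMorphism T
  ; _≈_ = λ f g → (v : Vertex T) → μ f v ≡ μ g v
  ; isEquivalence = record
    { refl  = λ v → refl
    ; sym   = λ p v → ≡.sym (p v)
    ; trans = λ p q v → ≡.trans (p v) (q v) } }

mutual
  leaves : Tree → ℕ
  leaves (node [])       = 1
  leaves (node (t ∷ ts)) = leavesF (t ∷ ts)

  leavesF : List Tree → ℕ
  leavesF []       = 0
  leavesF (t ∷ ts) = leaves t + leavesF ts

record GraftedTree : Set where
  constructor grafted
  field
    A  : Tree
    Bs : Vec Tree (leaves A)

mutual
  graft : (A : Tree) → Vec Tree (leaves A) → Tree
  graft (node [])       (B ∷ᵥ []ᵥ) = B
  graft (node (t ∷ ts)) v         = node (graftF (t ∷ ts) v)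

  graftF : (ts : List Tree) → Vec Tree (leavesF ts) → List Tree
  graftF []       []ᵥ = []
  graftF (t ∷ ts) v   = graft t (take (leaves t) v) ∷ graftF ts (drop (leaves t) v)

skeleton : GraftedTree → Tree
skeleton (grafted A Bs) = graft A Bs

GraftedWithSkeleton : Tree → Set
GraftedWithSkeleton T = Σ GraftedTree (λ G → skeleton G ≡ T)

GraftedWithSkeletonSetoid : Tree → Setoid _ _
GraftedWithSkeletonSetoid T = ≡.setoid (GraftedWithSkeleton T)

{-# OPTIONS --safe #-}
-- A grafted tree (A; B₁, …, B_d(A)) with skeleton T is determined by A read as a prefix of T,
-- a cut of T: the Bᵢ are then the subtrees of T hanging at the leaves of A. A cut in turn is
-- the same as the morphism μ : T → {1,2} equal to 1 exactly on the inner vertices of A: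
-- monotonicity says these vertices form a prefix of T together with all their sons, and
-- restrictedness says no leaf of T is among them.
module Submission where

open import Defs
open import Function.Base using (case_of_)
open import Function.Bundles using (Bijection; _↔_; mk↔ₛ′)
open import Function.Construct.Composition using (bijection)
open import Function.Properties.Inverse using (Inverse⇒Bijection)
open import Data.Fin using (Fin; zero; suc)
open import Data.List using (List; []; _∷_; length; lookup)
open import Data.List.Properties using (∷-dec)
open import Data.List.Relation.Unary.All using (All; []; _∷_)
open import Data.Product using (Σ; _,_; proj₁; proj₂)
open import Data.Vec using (Vec; take; drop; _++_) renaming ([] to []ᵥ; _∷_ to _∷ᵥ_)
open import Data.Vec.Properties using (take++drop≡id; ++-injective)
open import Relation.Nullary.Decidable using (yes; no; map′)
open import Relation.Binary.Definitions using (DecidableEquality)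
open import Relation.Binary.PropositionalEquality as ≡ using (_≡_; refl; sym; trans; cong; cong₂; _≗_)
open import Axiom.UniquenessOfIdentityProofs using (module Decidable⇒UIP)

-- `stop` marks a leaf of the prefix A, `go` an inner vertex of A, all of whose sons lie in A.
data Cut : Tree → Set where
  stop : ∀ {t} → Cut t
  go   : ∀ {t ts} → All Cut (t ∷ ts) → Cut (node (t ∷ ts))

lookupCut : ∀ {ts} → All Cut ts → (i : Fin (length ts)) → Cut (lookup ts i)
lookupCut (c ∷ cs) zero    = c
lookupCut (c ∷ cs) (suc i) = lookupCut cs i

IsMorphism : ∀ {T} → (Vertex T → Two) → Set
IsMorphism m = ∀ e → m (α e) ≤₂ m (ω e)

IsRestricted : ∀ {T} → (Vertex T → Two) → Set
IsRestricted m = ∀ v → IsLeaf v → m v ≡ two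

label : ∀ {T} → Cut T → Vertex T → Two
label stop    v           = two
label (go cs) root        = one
label (go cs) (child i v) = label (lookupCut cs i) v

one≤₂ : ∀ x → one ≤₂ x
one≤₂ one = 1≤1
one≤₂ two = 1≤2

label-isMorphism : ∀ {T} (c : Cut T) → IsMorphism (label c)
label-isMorphism stop    e            = 2≤2
label-isMorphism (go cs) (top i)      = one≤₂ _
label-isMorphism (go cs) (deeper i e) = label-isMorphism (lookupCut cs i) e

label-isRestricted : ∀ {T} (c : Cut T) → IsRestricted (label c)
label-isRestricted stop    v           _    = refl
label-isRestricted (go cs) (child i v) leaf = label-isRestricted (lookupCut cs i) v leaf

toMorphism : ∀ {T} → Cut T → RestrictedMorphism T
toMorphism c = record
  { μ = label c ; monotone = label-isMorphism c ; restricted = label-isRestricted c }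

mutual
  label-injective : ∀ {T} (c d : Cut T) → label c ≗ label d → c ≡ d
  label-injective stop    stop    _ = refl
  label-injective stop    (go _)  h = case h root of λ ()
  label-injective (go _)  stop    h = case h root of λ ()
  label-injective (go cs) (go ds) h = cong go (labels-injective cs ds λ i v → h (child i v))

  labels-injective : ∀ {ts} (cs ds : All Cut ts) →
    (∀ i → label (lookupCut cs i) ≗ label (lookupCut ds i)) → cs ≡ ds
  labels-injective []       []       _ = refl
  labels-injective (c ∷ cs) (d ∷ ds) h =
    cong₂ _∷_ (label-injective c d (h zero)) (labels-injective cs ds λ i → h (suc i))

SonLabelling : List Tree → Set
SonLabelling ts = (i : Fin (length ts)) → Vertex (lookup ts i) → Two

mutual
  cutOf : (T : Tree) → (Vertex T → Two) → Cut T
  cutOf (node ts) m = cutWithRoot ts (m root) λ i v → m (child i v)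

  cutWithRoot : (ts : List Tree) → Two → SonLabelling ts → Cut (node ts)
  cutWithRoot ts       two f = stop
  cutWithRoot []       one f = stop
  cutWithRoot (t ∷ ts) one f = go (cutsOf (t ∷ ts) f)

  cutsOf : (ts : List Tree) → SonLabelling ts → All Cut ts
  cutsOf []       f = []
  cutsOf (t ∷ ts) f = cutOf t (f zero) ∷ cutsOf ts λ i → f (suc i)

lookup-cutsOf : ∀ ts (f : SonLabelling ts) i → lookupCut (cutsOf ts f) i ≡ cutOf (lookup ts i) (f i)
lookup-cutsOf (t ∷ ts) f zero    = refl
lookup-cutsOf (t ∷ ts) f (suc i) = lookup-cutsOf ts (λ j → f (suc j)) i

≤₂-two : ∀ {x y} → x ≤₂ y → x ≡ two → y ≡ two
≤₂-two 2≤2 refl = refl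

root≡two⇒≡two : ∀ {T} {m : Vertex T → Two} → IsMorphism m → m root ≡ two → ∀ v → m v ≡ two
root≡two⇒≡two mono m-root root = m-root
root≡two⇒≡two {node ts} mono m-root (child i v) =
  root≡two⇒≡two (λ e → mono (deeper i e)) (≤₂-two (mono (top i)) m-root) v

label-cutOf : ∀ T (m : Vertex T → Two) → IsMorphism m → IsRestricted m → label (cutOf T m) ≗ m
label-cutOf (node ts) m mono restr v with m root in m-root
... | two = sym (root≡two⇒≡two mono m-root v)
label-cutOf (node []) m mono restr v | one = case trans (sym m-root) (restr root refl) of λ ()
label-cutOf (node (t ∷ ts)) m mono restr root | one = sym m-root
label-cutOf (node (t ∷ ts)) m mono restr (child i v) | one = trans
  (cong (λ c → label c v) (lookup-cutsOf (t ∷ ts) (λ j w → m (child j w)) i))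
  (label-cutOf _ (λ w → m (child i w)) (λ e → mono (deeper i e)) (λ w → restr (child i w)) v)

cut⤖morphism : (T : Tree) → Bijection (≡.setoid (Cut T)) (RestrictedMorphismSetoid T)
cut⤖morphism T = record
  { to        = toMorphism
  ; cong      = λ { refl v → refl }
  ; bijective = (λ {c} {d} → label-injective c d) , λ m →
      cutOf T (μ m) , λ { refl → label-cutOf T (μ m) (monotone m) (restricted m) } }

-- In the horticultural terms of grafting, A is the stock and B₁, …, B_d(A) are the scions.
mutual
  stock : ∀ {T} → Cut T → Tree
  stock stop    = node []
  stock (go cs) = node (stocks cs)

  stocks : ∀ {ts} → All Cut ts → List Tree
  stocks []       = []
  stocks (c ∷ cs) = stock c ∷ stocks cs

mutual
  scions : ∀ {T} (c : Cut T) → Vec Tree (leaves (stock c))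
  scions (stop {t})    = t ∷ᵥ []ᵥ
  scions (go (c ∷ cs)) = scionsF (c ∷ cs)

  scionsF : ∀ {ts} (cs : All Cut ts) → Vec Tree (leavesF (stocks cs))
  scionsF []       = []ᵥ
  scionsF (c ∷ cs) = scions c ++ scionsF cs

module _ {A : Set} {m n} (xs : Vec A m) (ys : Vec A n) where

  take-++ : take m (xs ++ ys) ≡ xs
  take-++ = proj₁ (++-injective (take m (xs ++ ys)) xs (take++drop≡id m (xs ++ ys)))

  drop-++ : drop m (xs ++ ys) ≡ ys
  drop-++ = proj₂ (++-injective (take m (xs ++ ys)) xs (take++drop≡id m (xs ++ ys)))

mutual
  graft-stock-scions : ∀ {T} (c : Cut T) → graft (stock c) (scions c) ≡ T
  graft-stock-scions stop          = refl
  graft-stock-scions (go (c ∷ cs)) = cong node (graftF-stocks-scionsF (c ∷ cs))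

  graftF-stocks-scionsF : ∀ {ts} (cs : All Cut ts) → graftF (stocks cs) (scionsF cs) ≡ ts
  graftF-stocks-scionsF []       = refl
  graftF-stocks-scionsF (c ∷ cs) = cong₂ _∷_
    (trans (cong (graft (stock c)) (take-++ (scions c) (scionsF cs))) (graft-stock-scions c))
    (trans (cong (graftF (stocks cs)) (drop-++ (scions c) (scionsF cs))) (graftF-stocks-scionsF cs))

-- Meaningful only when T is a grafting of A; the clauses for mismatched shapes are junk.
mutual
  cutAlong : Tree → (T : Tree) → Cut T
  cutAlong (node [])       T               = stop
  cutAlong (node (a ∷ as)) (node [])       = stop
  cutAlong (node (a ∷ as)) (node (t ∷ ts)) = go (cutsAlong (a ∷ as) (t ∷ ts))

  cutsAlong : List Tree → (ts : List Tree) → All Cut ts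
  cutsAlong _        []       = []
  cutsAlong []       (t ∷ ts) = stop ∷ cutsAlong [] ts
  cutsAlong (a ∷ as) (t ∷ ts) = cutAlong a t ∷ cutsAlong as ts

mutual
  cutAlong-stock : ∀ {T} (c : Cut T) → cutAlong (stock c) T ≡ c
  cutAlong-stock stop          = refl
  cutAlong-stock (go (c ∷ cs)) = cong go (cutsAlong-stocks (c ∷ cs))

  cutsAlong-stocks : ∀ {ts} (cs : All Cut ts) → cutsAlong (stocks cs) ts ≡ cs
  cutsAlong-stocks []       = refl
  cutsAlong-stocks (c ∷ cs) = cong₂ _∷_ (cutAlong-stock c) (cutsAlong-stocks cs)

GraftedForest : Set
GraftedForest = Σ (List Tree) λ as → Vec Tree (leavesF as)

_∷ᵍ_ : GraftedTree → GraftedForest → GraftedForest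
grafted a bs ∷ᵍ (as , bss) = a ∷ as , bs ++ bss

plant-cong : ∀ {a a′ as as′ bs bs′} →
  _≡_ {A = GraftedForest} (a ∷ as , bs) (a′ ∷ as′ , bs′) →
  grafted (node (a ∷ as)) bs ≡ grafted (node (a′ ∷ as′)) bs′
plant-cong refl = refl

mutual
  stock-scions-cutAlong : ∀ A (Bs : Vec Tree (leaves A)) → let c = cutAlong A (graft A Bs) in
    grafted (stock c) (scions c) ≡ grafted A Bs
  stock-scions-cutAlong (node [])       (B ∷ᵥ []ᵥ) = refl
  stock-scions-cutAlong (node (a ∷ as)) Bs        = plant-cong (stocks-scionsF-cutsAlong (a ∷ as) Bs)

  stocks-scionsF-cutsAlong : ∀ as (Bs : Vec Tree (leavesF as)) → let cs = cutsAlong as (graftF as Bs) in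
    _≡_ {A = GraftedForest} (stocks cs , scionsF cs) (as , Bs)
  stocks-scionsF-cutsAlong []       []ᵥ = refl
  stocks-scionsF-cutsAlong (a ∷ as) Bs  = trans
    (cong₂ _∷ᵍ_ (stock-scions-cutAlong a (take (leaves a) Bs)) (stocks-scionsF-cutsAlong as (drop (leaves a) Bs)))
    (cong (a ∷ as ,_) (take++drop≡id (leaves a) Bs))

toGrafted : ∀ {T} → Cut T → GraftedWithSkeleton T
toGrafted c = grafted (stock c) (scions c) , graft-stock-scions c

node-injective : ∀ {xs ys} → node xs ≡ node ys → xs ≡ ys
node-injective refl = refl

mutual
  _≟_ : DecidableEquality Tree
  node xs ≟ node ys = map′ (cong node) node-injective (xs ≟* ys)

  _≟*_ : DecidableEquality (List Tree)
  []       ≟* []       = yes refl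
  []       ≟* (_ ∷ _)  = no λ ()
  (_ ∷ _)  ≟* []       = no λ ()
  (x ∷ xs) ≟* (y ∷ ys) = ∷-dec (x ≟ y) (xs ≟* ys)

GraftedWithSkeleton-≡ : ∀ {T G H} (p : skeleton G ≡ T) (q : skeleton H ≡ T) →
  G ≡ H → _≡_ {A = GraftedWithSkeleton T} (G , p) (H , q)
GraftedWithSkeleton-≡ p q refl = cong (_ ,_) (Decidable⇒UIP.≡-irrelevant _≟_ p q)

toCut : ∀ {T} → GraftedWithSkeleton T → Cut T
toCut {T} (G , _) = cutAlong (GraftedTree.A G) T

toGrafted-toCut : ∀ {T} (G : GraftedWithSkeleton T) → toGrafted (toCut G) ≡ G
toGrafted-toCut (grafted A Bs , refl) = GraftedWithSkeleton-≡ _ refl (stock-scions-cutAlong A Bs)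

grafted↔cut : (T : Tree) → GraftedWithSkeleton T ↔ Cut T
grafted↔cut T = mk↔ₛ′ toCut toGrafted cutAlong-stock toGrafted-toCut

proposition7p1 : (T : Tree) →
    Bijection (GraftedWithSkeletonSetoid T) (RestrictedMorphismSetoid T)
proposition7p1 T = bijection (Inverse⇒Bijection (grafted↔cut T)) (cut⤖morphism T)
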